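{- Let $k \ge 3$ and let $0 \le v < \lvert I_{k-2}\rvert$ be an integer. Then $$\deg(B_{a_k+v}) = \deg(B_{a_{k-2}+v})+1 \quad\text{and}\quad \ell c(B_{a_k+v}) = \ell c(B_{a_{k-2}+v}).$$
   Context: The Stern polynomials $B_n(t)\in\mathbb{Z}[t]$ are defined by $B_0=0$, $B_1=1$, $B_{2n}=tB_n$, $B_{2n+1}=B_n+B_{n+1}$; $\ell c$ denotes the leading coefficient. A BSD representation of an integer is a digit string $(b_{m-1}\cdots b_0)$ with $b_j\in\{1,0,-1\}$ representing $\sum b_j2^j$. A non-adjacent form (NAF) is a BSD representation in which no two adjacent digits are both nonzero; it is reduced if its leading digit is nonzero. Every positive integer has exactly one reduced NAF; its length is the NAF-bitlength. $I_k$ denotes the set of positive integers of NAF-bitlength $k$ (a set of consecutive integers, e.g. $I_1=\{1\},I_2=\{2\},I_3=\{3,4,5\}$). Write $a_k=\min I_k$ for $k\ge 1$ (equivalently $a_1=1$, $a_2=2$, $a_k=2^{k-2}+a_{k-2}$ with $a_0=0$). -}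

module Defs where

open import Data.Nat using (ℕ; zero; suc; _+_; _∸_; _^_; _<_; ⌊_/2⌋)
open import Data.Integer as ℤ using (ℤ; +_; -[1+_])
open import Data.List using (List; []; _∷_; length; filter; concatMap; map; reverse)
open import Data.Bool using (Bool; true; false; _∧_; if_then_else_)
open import Data.Maybe using (Maybe; just; nothing)
open import Data.Unit using (⊤)
open import Data.Product using (_×_)

-- Polynomials in ℤ[t] as coefficient lists, lowest degree first.
-- (Trailing zeros allowed; degree / leading coefficient ignore them.)

Poly : Set
Poly = List ℤ

_⊕_ : Poly → Poly → Poly
[]       ⊕ q        = q
p        ⊕ []       = p
(a ∷ p)  ⊕ (b ∷ q)  = (a ℤ.+ b) ∷ (p ⊕ q)

tMul : Poly → Poly
tMul p = + 0 ∷ p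

isZeroℤ : ℤ → Bool
isZeroℤ (+ zero) = true
isZeroℤ _        = false

-- drop zero coefficients from the top (input given highest degree first)
dropZerosHigh : List ℤ → List ℤ
dropZerosHigh []      = []
dropZerosHigh (a ∷ p) = if isZeroℤ a then dropZerosHigh p else a ∷ p

normHigh : Poly → List ℤ
normHigh p = dropZerosHigh (reverse p)

deg : Poly → Maybe ℕ
deg p with normHigh p
... | []     = nothing
... | _ ∷ q  = just (length q)

-- leading coefficient (0 for the zero polynomial)
lc : Poly → ℤ
lc p with normHigh p
... | []     = + 0
... | a ∷ _  = a

-- Stern polynomials: B 0 = 0, B 1 = 1, B (2n) = t B n, B (2n+1) = B n + B (n+1).
-- Defined with a fuel argument (fuel > n suffices since halving decreases n).

isEven : ℕ → Bool
isEven zero          = true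
isEven (suc zero)    = false
isEven (suc (suc n)) = isEven n

Bfuel : ℕ → ℕ → Poly
Bfuel zero    _                = []
Bfuel (suc f) zero             = []
Bfuel (suc f) (suc zero)       = + 1 ∷ []
Bfuel (suc f) n@(suc (suc _))  =
  if isEven n then tMul (Bfuel f ⌊ n /2⌋)
              else Bfuel f ⌊ n /2⌋ ⊕ Bfuel f (suc ⌊ n /2⌋)

B : ℕ → Poly
B n = Bfuel (suc n) n

data Digit : Set where
  d-1 d0 d1 : Digit

digitℤ : Digit → ℤ
digitℤ d-1 = -[1+ 0 ]
digitℤ d0  = + 0
digitℤ d1  = + 1

nonzeroD : Digit → Bool
nonzeroD d0 = false
nonzeroD _  = true

-- digit strings are stored least significant digit first: b₀ ∷ b₁ ∷ …
value : List Digit → ℤ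
value []       = + 0
value (b ∷ bs) = digitℤ b ℤ.+ (+ 2) ℤ.* value bs

nonAdjacent : List Digit → Bool
nonAdjacent []             = true
nonAdjacent (_ ∷ [])       = true
nonAdjacent (b ∷ c ∷ bs)   =
  (if nonzeroD b ∧ nonzeroD c then false else true) ∧ nonAdjacent (c ∷ bs)

-- leading (most significant = last in list) digit nonzero
leadingNonzero : List Digit → Bool
leadingNonzero []           = false
leadingNonzero (b ∷ [])     = nonzeroD b
leadingNonzero (_ ∷ c ∷ bs) = leadingNonzero (c ∷ bs)

isPositive : ℤ → Bool
isPositive (+ suc _) = true
isPositive _         = false

strings : ℕ → List (List Digit)
strings zero    = [] ∷ []
strings (suc m) = concatMap (λ s → (d-1 ∷ s) ∷ (d0 ∷ s) ∷ (d1 ∷ s) ∷ []) (strings m)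

posReducedNAFs : ℕ → List (List Digit)
posReducedNAFs k = filter (λ s → (nonAdjacent s ∧ leadingNonzero s ∧ isPositive (value s)) Data.Bool.≟ true) (strings k)
  where import Data.Bool

-- |I_k|: since each positive integer has exactly one reduced NAF,
-- |I_k| is the number of reduced NAFs of length k with positive value.
cardI : ℕ → ℕ
cardI k = length (posReducedNAFs k)

-- a_k = min I_k, via the recursion a_0 = 0, a_1 = 1, a_2 = 2, a_k = 2^(k-2) + a_(k-2)
a : ℕ → ℕ
a zero                   = 0
a (suc zero)             = 1
a (suc (suc zero))       = 2
a (suc (suc (suc j)))    = 2 ^ (suc j) + a (suc j)

-- Write k = M + 2 and n = a_M + v, so that a_k + v = 2^M + n.  Counting reduced NAFs
-- gives a_M + |I_M| ≤ 2^M + 1, hence n ≤ 2^M, and for j = 2^M − n the Stern recurrences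
-- give B_(2^M + n) = t B_n + B_j.  Since 3 a_M > 2^M we also have j ≤ 2n, and induction on
-- M (n and j are both even or both odd) shows deg B_j ≤ deg B_n whenever n + j = 2^M and
-- j ≤ 2n; the odd step uses that the coefficients are nonnegative, so that
-- deg B_(2i+1) = max (deg B_i) (deg B_(i+1)).  Thus t B_n dominates B_j, and B_(a_k+v)
-- has degree deg B_n + 1 and the leading coefficient of B_n.

module Submission where

open import Defs
open import Data.Nat using (ℕ; zero; suc; _+_; _*_; _∸_; _^_; _≤_; _<_; _⊔_; z≤n; s≤s; ⌊_/2⌋)
import Data.Nat.Properties as ℕ
open import Data.Integer as ℤ using (ℤ; +_; +≤+)
import Data.Integer.Properties as ℤ
open import Data.List using (List; []; _∷_; _∷ʳ_; reverse; length; filter; concatMap)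
import Data.List.Properties as List
open import Data.List.Relation.Unary.All using (All; []; _∷_)
open import Data.Bool using (Bool; true; false; if_then_else_; _∧_)
import Data.Bool as Bool
open import Data.Maybe using (Maybe; just; nothing; map; maybe′)
open import Data.Product using (_×_; _,_; proj₁; proj₂; map₁)
open import Data.Empty using (⊥-elim)
open import Data.Sum using (inj₁; inj₂)
open import Level using (0ℓ)
open import Data.Nat.Tactic.RingSolver using (solve-∀)
open import Relation.Binary.Bundles using (Setoid)
import Relation.Binary.Reasoning.Setoid
open import Relation.Binary.PropositionalEquality
  using (_≡_; _≢_; refl; sym; trans; cong; cong₂; subst; subst₂; module ≡-Reasoning)
open import Relation.Binary.Construct.Add.Infimum.NonStrict _≤_
  using (_≤₋_; ⊥₋≤_; [_]; ≤₋-trans; ≤₋-reflexive-≡)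
open import Relation.Binary.Construct.Add.Infimum.Strict _<_
  using (_<₋_; ⊥₋<[_]; [_])
open import Algebra.Properties.CommutativeSemigroup ℤ.+-commutativeSemigroup
  using (interchange)


coeff : Poly → ℕ → ℤ
coeff []      _       = + 0
coeff (c ∷ p) zero    = c
coeff (c ∷ p) (suc i) = coeff p i

infix 4 _≈_
record _≈_ (p q : Poly) : Set where
  constructor coeffwise
  field coeff-≡ : ∀ i → coeff p i ≡ coeff q i
open _≈_

≈-refl : ∀ {p} → p ≈ p
≈-refl = coeffwise λ _ → refl

≈-sym : ∀ {p q} → p ≈ q → q ≈ p
≈-sym (coeffwise e) = coeffwise λ i → sym (e i)

≈-reflexive : ∀ {p q} → p ≡ q → p ≈ q
≈-reflexive refl = ≈-refl

≈-trans : ∀ {p q r} → p ≈ q → q ≈ r → p ≈ r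
≈-trans (coeffwise e) (coeffwise f) = coeffwise λ i → trans (e i) (f i)

≈-setoid : Setoid 0ℓ 0ℓ
≈-setoid = record
  { Carrier       = Poly
  ; _≈_           = _≈_
  ; isEquivalence = record
    { refl  = ≈-refl
    ; sym   = ≈-sym
    ; trans = ≈-trans
    }
  }

module ≈-Reasoning = Relation.Binary.Reasoning.Setoid ≈-setoid

≈-tail : ∀ {c d p q} → c ∷ p ≈ d ∷ q → p ≈ q
≈-tail (coeffwise e) = coeffwise λ i → e (suc i)

≈[]-tail : ∀ {c p} → c ∷ p ≈ [] → p ≈ []
≈[]-tail (coeffwise e) = coeffwise λ i → e (suc i)

∷-≈[] : ∀ {c p} → c ≡ + 0 → p ≈ [] → c ∷ p ≈ []
∷-≈[] c≡0 (coeffwise e) = coeffwise λ where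
  zero    → c≡0
  (suc i) → e i

coeff-⊕ : ∀ p q i → coeff (p ⊕ q) i ≡ coeff p i ℤ.+ coeff q i
coeff-⊕ []      q       i       = sym (ℤ.+-identityˡ _)
coeff-⊕ (c ∷ p) []      i       = sym (ℤ.+-identityʳ _)
coeff-⊕ (c ∷ p) (d ∷ q) zero    = refl
coeff-⊕ (c ∷ p) (d ∷ q) (suc i) = coeff-⊕ p q i

⊕-cong : ∀ {p p′ q q′} → p ≈ p′ → q ≈ q′ → p ⊕ q ≈ p′ ⊕ q′
⊕-cong {p} {p′} {q} {q′} (coeffwise e) (coeffwise f) = coeffwise λ i →
  trans (coeff-⊕ p q i) (trans (cong₂ ℤ._+_ (e i) (f i)) (sym (coeff-⊕ p′ q′ i)))

⊕-comm : ∀ p q → p ⊕ q ≈ q ⊕ p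
⊕-comm p q = coeffwise λ i →
  trans (coeff-⊕ p q i) (trans (ℤ.+-comm (coeff p i) _) (sym (coeff-⊕ q p i)))

⊕-interchange : ∀ p q r s → (p ⊕ q) ⊕ (r ⊕ s) ≈ (p ⊕ r) ⊕ (q ⊕ s)
⊕-interchange p q r s = coeffwise λ i → begin
  coeff ((p ⊕ q) ⊕ (r ⊕ s)) i
    ≡⟨ trans (coeff-⊕ (p ⊕ q) (r ⊕ s) i) (cong₂ ℤ._+_ (coeff-⊕ p q i) (coeff-⊕ r s i)) ⟩
  (coeff p i ℤ.+ coeff q i) ℤ.+ (coeff r i ℤ.+ coeff s i)
    ≡⟨ interchange (coeff p i) (coeff q i) (coeff r i) (coeff s i) ⟩
  (coeff p i ℤ.+ coeff r i) ℤ.+ (coeff q i ℤ.+ coeff s i)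
    ≡⟨ sym (trans (coeff-⊕ (p ⊕ r) (q ⊕ s) i) (cong₂ ℤ._+_ (coeff-⊕ p r i) (coeff-⊕ q s i))) ⟩
  coeff ((p ⊕ r) ⊕ (q ⊕ s)) i ∎
  where open ≡-Reasoning

⊕-identityʳ : ∀ {p q} → q ≈ [] → p ⊕ q ≈ p
⊕-identityʳ {p} {q} (coeffwise e) = coeffwise λ i →
  trans (coeff-⊕ p q i) (trans (cong (λ x → coeff p i ℤ.+ x) (e i)) (ℤ.+-identityʳ _))

tMul-cong : ∀ {p q} → p ≈ q → tMul p ≈ tMul q
tMul-cong (coeffwise e) = coeffwise λ where
  zero    → refl
  (suc i) → e i


-- (degree, leading coefficient), or nothing for the zero polynomial; it is computed
-- from the constant term upwards, unlike deg and lc, to make it structurally recursive.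
consLead : ℤ → Maybe (ℕ × ℤ) → Maybe (ℕ × ℤ)
consLead c nothing        = if isZeroℤ c then nothing else just (0 , c)
consLead c (just (d , l)) = just (suc d , l)

lead : Poly → Maybe (ℕ × ℤ)
lead []      = nothing
lead (c ∷ p) = consLead c (lead p)

degree : Poly → Maybe ℕ
degree p = map proj₁ (lead p)

leadCoeff : Poly → ℤ
leadCoeff p = maybe′ proj₂ (+ 0) (lead p)

leadHigh : List ℤ → Maybe (ℕ × ℤ)
leadHigh []       = nothing
leadHigh (c ∷ cs) = just (length cs , c)

leadHigh-dropZerosHigh-∷ʳ : ∀ cs c →
  leadHigh (dropZerosHigh (cs ∷ʳ c)) ≡ consLead c (leadHigh (dropZerosHigh cs))
leadHigh-dropZerosHigh-∷ʳ [] c with isZeroℤ c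
... | true  = refl
... | false = refl
leadHigh-dropZerosHigh-∷ʳ (h ∷ cs) c with isZeroℤ h
... | true  = leadHigh-dropZerosHigh-∷ʳ cs c
... | false = cong (λ d → just (d , h)) (trans (List.length-++ cs) (ℕ.+-comm (length cs) 1))

leadHigh-normHigh : ∀ p → leadHigh (normHigh p) ≡ lead p
leadHigh-normHigh []      = refl
leadHigh-normHigh (c ∷ p) = begin
  leadHigh (dropZerosHigh (reverse (c ∷ p)))
    ≡⟨ cong (λ cs → leadHigh (dropZerosHigh cs)) (List.unfold-reverse c p) ⟩
  leadHigh (dropZerosHigh (reverse p ∷ʳ c))
    ≡⟨ leadHigh-dropZerosHigh-∷ʳ (reverse p) c ⟩
  consLead c (leadHigh (normHigh p))
    ≡⟨ cong (consLead c) (leadHigh-normHigh p) ⟩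
  consLead c (lead p)
    ∎
  where open ≡-Reasoning

deg≡degree : ∀ p → deg p ≡ degree p
deg≡degree p = trans (viaHigh p) (cong (map proj₁) (leadHigh-normHigh p))
  where
  viaHigh : ∀ p → deg p ≡ map proj₁ (leadHigh (normHigh p))
  viaHigh p with normHigh p
  ... | []    = refl
  ... | _ ∷ _ = refl

lc≡leadCoeff : ∀ p → lc p ≡ leadCoeff p
lc≡leadCoeff p = trans (viaHigh p) (cong (maybe′ proj₂ (+ 0)) (leadHigh-normHigh p))
  where
  viaHigh : ∀ p → lc p ≡ maybe′ proj₂ (+ 0) (leadHigh (normHigh p))
  viaHigh p with normHigh p
  ... | []    = refl
  ... | _ ∷ _ = refl

lead-zero : ∀ {p} → p ≈ [] → lead p ≡ nothing
lead-zero {[]}    e = refl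
lead-zero {c ∷ p} e rewrite lead-zero (≈[]-tail e) | coeff-≡ e 0 = refl

lead-cong : ∀ {p q} → p ≈ q → lead p ≡ lead q
lead-cong {[]}    {[]}    e = refl
lead-cong {[]}    {d ∷ q} e = sym (lead-zero (≈-sym e))
lead-cong {c ∷ p} {[]}    e = lead-zero e
lead-cong {c ∷ p} {d ∷ q} e = cong₂ consLead (coeff-≡ e 0) (lead-cong (≈-tail e))

degree-cong : ∀ {p q} → p ≈ q → degree p ≡ degree q
degree-cong e = cong (map proj₁) (lead-cong e)

lead-tMul : ∀ p → lead (tMul p) ≡ map (map₁ suc) (lead p)
lead-tMul p with lead p
... | nothing = refl
... | just _  = refl

degree-tMul : ∀ p → degree (tMul p) ≡ map suc (degree p)
degree-tMul p rewrite lead-tMul p with lead p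
... | nothing = refl
... | just _  = refl

consDeg : ℤ → Maybe ℕ → Maybe ℕ
consDeg c nothing  = if isZeroℤ c then nothing else just 0
consDeg c (just d) = just (suc d)

degree-∷ : ∀ c p → degree (c ∷ p) ≡ consDeg c (degree p)
degree-∷ c p with lead p
... | just _  = refl
... | nothing with isZeroℤ c
...   | true  = refl
...   | false = refl

consDeg≡nothing : ∀ {c D} → consDeg c D ≡ nothing → c ≡ + 0 × D ≡ nothing
consDeg≡nothing {+ zero}     {nothing} _ = refl , refl
consDeg≡nothing {+ suc _}    {nothing} ()
consDeg≡nothing {ℤ.-[1+ _ ]} {nothing} ()

degree≡nothing⇒≈[] : ∀ {p} → degree p ≡ nothing → p ≈ []
degree≡nothing⇒≈[] {[]}    _ = ≈-refl
degree≡nothing⇒≈[] {c ∷ p} e =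
  let c≡0 , degree-p≡nothing = consDeg≡nothing (trans (sym (degree-∷ c p)) e)
  in ∷-≈[] c≡0 (degree≡nothing⇒≈[] degree-p≡nothing)

consDeg-<₋-just : ∀ {d k} E → consDeg d E <₋ just (suc k) → E <₋ just k
consDeg-<₋-just nothing  _            = ⊥₋<[ _ ]
consDeg-<₋-just (just _) [ s≤s k′<k ] = [ k′<k ]

<₋-degree-constant : ∀ {c D} → D <₋ degree (c ∷ []) → D ≡ nothing
<₋-degree-constant {c} h with isZeroℤ c
<₋-degree-constant     ()        | true
<₋-degree-constant     ⊥₋<[ _ ] | false = refl

lead-⊕-dominant : ∀ {p q} → degree q <₋ degree p → lead (p ⊕ q) ≡ lead p
lead-⊕-dominant {[]}    ()
lead-⊕-dominant {_ ∷ _} {[]}    _ = refl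
lead-⊕-dominant {c ∷ p} {d ∷ q} h with lead p in e
... | just (k , l) = cong (consLead (c ℤ.+ d)) (trans (lead-⊕-dominant {p} {q} q<p) e)
  where
  q<p : degree q <₋ degree p
  q<p = subst (degree q <₋_) (sym (cong (map proj₁) e))
          (consDeg-<₋-just (degree q) (subst (_<₋ just (suc k)) (degree-∷ d q) h))
... | nothing = trans (lead-cong (⊕-identityʳ {c ∷ p} d∷q≈[])) (cong (consLead c) e)
  where
  d∷q≈[] : d ∷ q ≈ []
  d∷q≈[] = degree≡nothing⇒≈[] {d ∷ q} (<₋-degree-constant {c} h)

lead-tMul-⊕ : ∀ p q → degree q ≤₋ degree p → lead (tMul p ⊕ q) ≡ map (map₁ suc) (lead p)
lead-tMul-⊕ p q h with degree q in eq
... | nothing = trans (lead-cong (⊕-identityʳ {tMul p} (degree≡nothing⇒≈[] {q} eq))) (lead-tMul p)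
... | just k  = trans (lead-⊕-dominant {tMul p} {q} q<tp) (lead-tMul p)
  where
  <₋-map-suc : ∀ {E} → just k ≤₋ E → just k <₋ map suc E
  <₋-map-suc [ k≤e ] = [ s≤s k≤e ]
  q<tp : degree q <₋ degree (tMul p)
  q<tp = subst₂ _<₋_ (sym eq) (sym (degree-tMul p)) (<₋-map-suc h)

deg-lc-lead-shift : ∀ p q → lead q ≡ map (map₁ suc) (lead p) →
  deg q ≡ map suc (deg p) × lc q ≡ lc p
deg-lc-lead-shift p q e
  rewrite deg≡degree p | deg≡degree q | lc≡leadCoeff p | lc≡leadCoeff q
  with lead p | lead q | e
... | nothing | .nothing | refl = refl , refl
... | just _  | .(just _) | refl = refl , refl


-- Degree of a sum of polynomials with nonnegative coefficients

≤₋-refl : ∀ {D} → D ≤₋ D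
≤₋-refl = ≤₋-reflexive-≡ ℕ.≤-reflexive refl

map-suc-mono : ∀ {D E} → D ≤₋ E → map suc D ≤₋ map suc E
map-suc-mono (⊥₋≤ _) = ⊥₋≤ _
map-suc-mono [ d≤e ] = [ s≤s d≤e ]

infixl 6 _⊔₋_
_⊔₋_ : Maybe ℕ → Maybe ℕ → Maybe ℕ
nothing ⊔₋ E       = E
just d  ⊔₋ nothing = just d
just d  ⊔₋ just e  = just (d ⊔ e)

⊔₋-identityʳ : ∀ D → D ⊔₋ nothing ≡ D
⊔₋-identityʳ nothing  = refl
⊔₋-identityʳ (just _) = refl

⊔₋-upperˡ : ∀ D E → D ≤₋ D ⊔₋ E
⊔₋-upperˡ nothing  E        = ⊥₋≤ _
⊔₋-upperˡ (just d) nothing  = ≤₋-refl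
⊔₋-upperˡ (just d) (just e) = [ ℕ.m≤m⊔n d e ]

⊔₋-upperʳ : ∀ D E → E ≤₋ D ⊔₋ E
⊔₋-upperʳ nothing  E        = ≤₋-refl
⊔₋-upperʳ (just d) nothing  = ⊥₋≤ _
⊔₋-upperʳ (just d) (just e) = [ ℕ.m≤n⊔m d e ]

⊔₋-lub : ∀ {D E F} → D ≤₋ F → E ≤₋ F → D ⊔₋ E ≤₋ F
⊔₋-lub (⊥₋≤ _) E≤F     = E≤F
⊔₋-lub [ d≤f ] (⊥₋≤ _) = [ d≤f ]
⊔₋-lub [ d≤f ] [ e≤f ] = [ ℕ.⊔-lub d≤f e≤f ]

NonNegPoly : Poly → Set
NonNegPoly = All (+ 0 ℤ.≤_)

⊕-nonNeg : ∀ {p q} → NonNegPoly p → NonNegPoly q → NonNegPoly (p ⊕ q)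
⊕-nonNeg []         nq         = nq
⊕-nonNeg (c≥0 ∷ np) []         = c≥0 ∷ np
⊕-nonNeg (c≥0 ∷ np) (d≥0 ∷ nq) = ℤ.+-mono-≤ c≥0 d≥0 ∷ ⊕-nonNeg np nq

consDeg-+ : ∀ k l D E → consDeg (+ (k + l)) (D ⊔₋ E) ≡ consDeg (+ k) D ⊔₋ consDeg (+ l) E
consDeg-+ zero    zero    nothing  nothing  = refl
consDeg-+ zero    (suc _) nothing  nothing  = refl
consDeg-+ (suc _) zero    nothing  nothing  = refl
consDeg-+ (suc _) (suc _) nothing  nothing  = refl
consDeg-+ zero    _       nothing  (just _) = refl
consDeg-+ (suc _) _       nothing  (just _) = refl
consDeg-+ _       zero    (just _) nothing  = refl
consDeg-+ _       (suc _) (just _) nothing  = refl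
consDeg-+ _       _       (just _) (just _) = refl

degree-⊕ : ∀ {p q} → NonNegPoly p → NonNegPoly q → degree (p ⊕ q) ≡ degree p ⊔₋ degree q
degree-⊕ []                          _          = refl
degree-⊕ {c ∷ p}           (_ ∷ _)   []         = sym (⊔₋-identityʳ (degree (c ∷ p)))
degree-⊕ {+ k ∷ p} {+ l ∷ q} (+≤+ _ ∷ np) (+≤+ _ ∷ nq) = begin
  degree (+ (k + l) ∷ (p ⊕ q))
    ≡⟨ degree-∷ (+ (k + l)) (p ⊕ q) ⟩
  consDeg (+ (k + l)) (degree (p ⊕ q))
    ≡⟨ cong (consDeg (+ (k + l))) (degree-⊕ np nq) ⟩
  consDeg (+ (k + l)) (degree p ⊔₋ degree q)
    ≡⟨ consDeg-+ k l (degree p) (degree q) ⟩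
  consDeg (+ k) (degree p) ⊔₋ consDeg (+ l) (degree q)
    ≡⟨ cong₂ _⊔₋_ (degree-∷ (+ k) p) (degree-∷ (+ l) q) ⟨
  degree (+ k ∷ p) ⊔₋ degree (+ l ∷ q)
    ∎
  where open ≡-Reasoning


-- Structural doubling, on which isEven and ⌊_/2⌋ compute.
double : ℕ → ℕ
double zero    = zero
double (suc n) = suc (suc (double n))

double≡2* : ∀ n → double n ≡ 2 * n
double≡2* zero    = refl
double≡2* (suc n) = cong suc (trans (cong suc (double≡2* n)) (sym (ℕ.+-suc n (n + 0))))

double-+ : ∀ m n → double (m + n) ≡ double m + double n
double-+ zero    n = refl
double-+ (suc m) n = cong (λ k → suc (suc k)) (double-+ m n)

double-injective : ∀ {m n} → double m ≡ double n → m ≡ n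
double-injective {zero}  {zero}  _ = refl
double-injective {suc m} {suc n} e = cong suc (double-injective (ℕ.suc-injective (ℕ.suc-injective e)))

double≢suc-double : ∀ m n → double m ≢ suc (double n)
double≢suc-double (suc m) (suc n) e = double≢suc-double m n (ℕ.suc-injective (ℕ.suc-injective e))

double≤suc-double⇒≤ : ∀ {m n} → double m ≤ suc (double n) → m ≤ n
double≤suc-double⇒≤ {zero}              _               = z≤n
double≤suc-double⇒≤ {suc m} {suc n} (s≤s (s≤s le)) = s≤s (double≤suc-double⇒≤ le)

n≤double : ∀ n → n ≤ double n
n≤double zero    = z≤n
n≤double (suc n) = s≤s (ℕ.m≤n⇒m≤1+n (n≤double n))

2^suc≡double : ∀ m → 2 ^ suc m ≡ double (2 ^ m)
2^suc≡double m = sym (double≡2* (2 ^ m))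

2^suc+double≡double : ∀ m n → 2 ^ suc m + double n ≡ double (2 ^ m + n)
2^suc+double≡double m n = trans (cong (_+ double n) (2^suc≡double m)) (sym (double-+ (2 ^ m) n))

isEven-double : ∀ n → isEven (double n) ≡ true
isEven-double zero    = refl
isEven-double (suc n) = isEven-double n

isEven-suc-double : ∀ n → isEven (suc (double n)) ≡ false
isEven-suc-double zero    = refl
isEven-suc-double (suc n) = isEven-suc-double n

⌊double/2⌋ : ∀ n → ⌊ double n /2⌋ ≡ n
⌊double/2⌋ zero    = refl
⌊double/2⌋ (suc n) = cong suc (⌊double/2⌋ n)

⌊suc-double/2⌋ : ∀ n → ⌊ suc (double n) /2⌋ ≡ n
⌊suc-double/2⌋ zero    = refl
⌊suc-double/2⌋ (suc n) = cong suc (⌊suc-double/2⌋ n)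

data Parity : ℕ → Set where
  even : ∀ k → Parity (double k)
  odd  : ∀ k → Parity (suc (double k))

parity : ∀ n → Parity n
parity zero = even zero
parity (suc n) with parity n
... | even k = odd k
... | odd k  = even (suc k)

data DoubleSplit (P : ℕ) : ℕ → ℕ → Set where
  even-split : ∀ {n j} → n + j ≡ P → DoubleSplit P (double n) (double j)
  odd-split  : ∀ {n j} → suc (n + j) ≡ P → DoubleSplit P (suc (double n)) (suc (double j))

doubleSplit : ∀ {P} n j → n + j ≡ double P → DoubleSplit P n j
doubleSplit {P} n j e with parity n | parity j
... | even n′ | even j′ = even-split (double-injective (trans (double-+ n′ j′) e))
... | odd n′  | odd j′  = odd-split (double-injective (begin
  double (suc (n′ + j′))                ≡⟨ cong (λ k → suc (suc k)) (double-+ n′ j′) ⟩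
  suc (suc (double n′ + double j′))     ≡⟨ cong suc (sym (ℕ.+-suc (double n′) (double j′))) ⟩
  suc (double n′) + suc (double j′)     ≡⟨ e ⟩
  double P                              ∎))
  where open ≡-Reasoning
... | even n′ | odd j′  = ⊥-elim (double≢suc-double P (n′ + j′) (begin
  double P                              ≡⟨ sym e ⟩
  double n′ + suc (double j′)           ≡⟨ ℕ.+-suc (double n′) (double j′) ⟩
  suc (double n′ + double j′)           ≡⟨ cong suc (sym (double-+ n′ j′)) ⟩
  suc (double (n′ + j′))                ∎))
  where open ≡-Reasoning
... | odd n′  | even j′ = ⊥-elim (double≢suc-double P (n′ + j′)
  (trans (sym e) (cong suc (sym (double-+ n′ j′)))))


Bfuel-irrelevant : ∀ {f g} n → n < f → n < g → Bfuel f n ≡ Bfuel g n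
Bfuel-irrelevant {suc f} {suc g} zero                _       _       = refl
Bfuel-irrelevant {suc f} {suc g} (suc zero)          _       _       = refl
Bfuel-irrelevant {suc f} {suc g} (suc (suc zero))    (s≤s p) (s≤s q) =
  cong tMul (Bfuel-irrelevant 1 p q)
Bfuel-irrelevant {suc f} {suc g} n@(suc (suc (suc k))) (s≤s p) (s≤s q) =
  cong₂ (λ x y → if isEven (suc k) then tMul x else x ⊕ y)
    (Bfuel-irrelevant h (ℕ.≤-trans h<n p) (ℕ.≤-trans h<n q))
    (Bfuel-irrelevant (suc h) (ℕ.≤-trans 1+h<n p) (ℕ.≤-trans 1+h<n q))
  where
  h = ⌊ n /2⌋
  h<n : h < n
  h<n = s≤s (s≤s (ℕ.⌊n/2⌋≤n (suc k)))
  1+h<n : suc h < n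
  1+h<n = s≤s (s≤s (ℕ.⌊n/2⌋<n k))

B-double-suc : ∀ n → B (double (suc n)) ≡ tMul (B (suc n))
B-double-suc n rewrite isEven-double n | ⌊double/2⌋ n =
  cong tMul (Bfuel-irrelevant (suc n) (s≤s (s≤s (n≤double n))) ℕ.≤-refl)

B-suc-double-suc : ∀ n → B (suc (double (suc n))) ≡ B (suc n) ⊕ B (suc (suc n))
B-suc-double-suc n rewrite isEven-suc-double n | ⌊suc-double/2⌋ n =
  cong₂ _⊕_ (Bfuel-irrelevant (suc n) (s≤s (s≤s (ℕ.m≤n⇒m≤1+n (n≤double n)))) ℕ.≤-refl)
            (Bfuel-irrelevant (suc (suc n)) (s≤s (s≤s (s≤s (n≤double n)))) ℕ.≤-refl)

B-double : ∀ n → B (double n) ≈ tMul (B n)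
B-double zero    = coeffwise λ where
  zero    → refl
  (suc _) → refl
B-double (suc n) = ≈-reflexive (B-double-suc n)

B-suc-double : ∀ n → B (suc (double n)) ≈ B n ⊕ B (suc n)
B-suc-double zero    = ≈-refl
B-suc-double (suc n) = ≈-reflexive (B-suc-double-suc n)

Bfuel-nonNeg : ∀ f n → NonNegPoly (Bfuel f n)
Bfuel-nonNeg zero    _             = []
Bfuel-nonNeg (suc f) zero          = []
Bfuel-nonNeg (suc f) (suc zero)    = +≤+ z≤n ∷ []
Bfuel-nonNeg (suc f) (suc (suc k)) with isEven k
... | true  = +≤+ z≤n ∷ Bfuel-nonNeg f _
... | false = ⊕-nonNeg (Bfuel-nonNeg f _) (Bfuel-nonNeg f _)

B-nonNeg : ∀ n → NonNegPoly (B n)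
B-nonNeg n = Bfuel-nonNeg (suc n) n

degree-B-double : ∀ n → degree (B (double n)) ≡ map suc (degree (B n))
degree-B-double n = trans (degree-cong (B-double n)) (degree-tMul (B n))

degree-B-suc-double : ∀ n → degree (B (suc (double n))) ≡ degree (B n) ⊔₋ degree (B (suc n))
degree-B-suc-double n = trans (degree-cong (B-suc-double n)) (degree-⊕ (B-nonNeg n) (B-nonNeg (suc n)))

B-2^m+n : ∀ m {n j} → n + j ≡ 2 ^ m → B (2 ^ m + n) ≈ tMul (B n) ⊕ B j
B-2^m+n zero    {zero}        {suc zero}    _ = ≈-refl
B-2^m+n zero    {suc zero}    {zero}        _ = ≈-refl
B-2^m+n zero    {zero}        {zero}        ()
B-2^m+n zero    {zero}        {suc (suc _)} ()
B-2^m+n zero    {suc zero}    {suc _}       ()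
B-2^m+n zero    {suc (suc _)}               ()
B-2^m+n (suc m) {n} {j} e with doubleSplit n j (trans e (2^suc≡double m))
... | even-split {n′} {j′} e′ = begin
  B (2 ^ suc m + double n′)               ≡⟨ cong B (2^suc+double≡double m n′) ⟩
  B (double (2 ^ m + n′))                 ≈⟨ B-double (2 ^ m + n′) ⟩
  tMul (B (2 ^ m + n′))                   ≈⟨ tMul-cong (B-2^m+n m e′) ⟩
  tMul (tMul (B n′)) ⊕ tMul (B j′)        ≈⟨ ⊕-cong (tMul-cong (B-double n′)) (B-double j′) ⟨
  tMul (B (double n′)) ⊕ B (double j′)    ∎
  where open ≈-Reasoning
... | odd-split {n′} {j′} e′ = begin
  B (2 ^ suc m + suc (double n′))
    ≡⟨ cong B (trans (ℕ.+-suc (2 ^ suc m) (double n′)) (cong suc (2^suc+double≡double m n′))) ⟩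
  B (suc (double (2 ^ m + n′)))
    ≈⟨ B-suc-double (2 ^ m + n′) ⟩
  B (2 ^ m + n′) ⊕ B (suc (2 ^ m + n′))
    ≡⟨ cong (λ k → B (2 ^ m + n′) ⊕ B k) (ℕ.+-suc (2 ^ m) n′) ⟨
  B (2 ^ m + n′) ⊕ B (2 ^ m + suc n′)
    ≈⟨ ⊕-cong (B-2^m+n m (trans (ℕ.+-suc n′ j′) e′)) (B-2^m+n m e′) ⟩
  (tMul (B n′) ⊕ B (suc j′)) ⊕ (tMul (B (suc n′)) ⊕ B j′)
    ≈⟨ ⊕-interchange (tMul (B n′)) (B (suc j′)) (tMul (B (suc n′))) (B j′) ⟩
  tMul (B n′ ⊕ B (suc n′)) ⊕ (B (suc j′) ⊕ B j′)
    ≈⟨ ⊕-cong (≈-refl {tMul (B n′ ⊕ B (suc n′))}) (⊕-comm (B (suc j′)) (B j′)) ⟩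
  tMul (B n′ ⊕ B (suc n′)) ⊕ (B j′ ⊕ B (suc j′))
    ≈⟨ ⊕-cong (tMul-cong (B-suc-double n′)) (B-suc-double j′) ⟨
  tMul (B (suc (double n′))) ⊕ B (suc (double j′))
    ∎
  where open ≈-Reasoning

degree-B-dominates : ∀ m {n j} → n + j ≡ 2 ^ m → j ≤ double n → degree (B j) ≤₋ degree (B n)
degree-B-dominates zero    {suc zero}    {zero}        _ _ = ⊥₋≤ _
degree-B-dominates zero    {zero}        {suc zero}    _ ()
degree-B-dominates zero    {zero}        {zero}        ()
degree-B-dominates zero    {zero}        {suc (suc _)} ()
degree-B-dominates zero    {suc zero}    {suc _}       ()
degree-B-dominates zero    {suc (suc _)}               ()
degree-B-dominates (suc m) {n} {j} e j≤2n with doubleSplit n j (trans e (2^suc≡double m))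
... | even-split {n′} {j′} e′
  rewrite degree-B-double j′ | degree-B-double n′ =
  map-suc-mono (degree-B-dominates m e′ (double≤suc-double⇒≤ (ℕ.m≤n⇒m≤1+n j≤2n)))
... | odd-split {n′} {j′} e′
  rewrite degree-B-suc-double j′ | degree-B-suc-double n′ =
  ⊔₋-lub (≤₋-trans ℕ.≤-trans j′-bound (⊔₋-upperʳ _ _)) suc-j′-bound
  where
  j′≤2n′ : j′ ≤ double n′
  j′≤2n′ = double≤suc-double⇒≤ (ℕ.≤-pred j≤2n)
  j′-bound : degree (B j′) ≤₋ degree (B (suc n′))
  j′-bound = degree-B-dominates m e′ (ℕ.m≤n⇒m≤1+n (ℕ.m≤n⇒m≤1+n j′≤2n′))
  suc-j′-bound : degree (B (suc j′)) ≤₋ degree (B n′) ⊔₋ degree (B (suc n′))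
  suc-j′-bound with ℕ.m≤n⇒m<n∨m≡n j′≤2n′
  ... | inj₁ j′<2n′ = ≤₋-trans ℕ.≤-trans
    (degree-B-dominates m (trans (ℕ.+-suc n′ j′) e′) j′<2n′) (⊔₋-upperˡ _ _)
  -- when j′ = double n′, B (suc j′) is B n itself
  ... | inj₂ refl   = ≤₋-reflexive-≡ ℕ.≤-reflexive (degree-B-suc-double n′)


-- Counting reduced NAFs

count : ∀ {A : Set} → (A → Bool) → List A → ℕ
count f []       = 0
count f (x ∷ xs) = (if f x then 1 else 0) + count f xs

length-filter≡count : ∀ {A : Set} (f : A → Bool) xs →
  length (filter (λ x → f x Bool.≟ true) xs) ≡ count f xs
length-filter≡count f []       = refl
length-filter≡count f (x ∷ xs) with f x
... | true  = cong suc (length-filter≡count f xs)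
... | false = length-filter≡count f xs

count-mono : ∀ {A : Set} {f g : A → Bool} → (∀ x → f x ≡ true → g x ≡ true) →
  ∀ xs → count f xs ≤ count g xs
count-mono     f⇒g []       = z≤n
count-mono {f = f} {g} f⇒g (x ∷ xs) with f x in fx | g x in gx
... | true  | true  = s≤s (count-mono f⇒g xs)
... | false | true  = ℕ.m≤n⇒m≤1+n (count-mono f⇒g xs)
... | false | false = count-mono f⇒g xs
... | true  | false with () ← trans (sym (f⇒g x fx)) gx

count-cong : ∀ {A : Set} {f g : A → Bool} → (∀ x → f x ≡ g x) → ∀ xs → count f xs ≡ count g xs
count-cong f≡g []       = refl
count-cong f≡g (x ∷ xs) = cong₂ (λ b k → (if b then 1 else 0) + k) (f≡g x) (count-cong f≡g xs)

count-false : ∀ {A : Set} (xs : List A) → count (λ _ → false) xs ≡ 0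
count-false []       = refl
count-false (_ ∷ xs) = count-false xs

count-strings-suc : ∀ f m → count f (strings (suc m)) ≡
  count (λ s → f (d-1 ∷ s)) (strings m) +
    (count (λ s → f (d0 ∷ s)) (strings m) + count (λ s → f (d1 ∷ s)) (strings m))
count-strings-suc f m = go (strings m)
  where
  go : ∀ ss → count f (concatMap (λ s → (d-1 ∷ s) ∷ (d0 ∷ s) ∷ (d1 ∷ s) ∷ []) ss) ≡
    count (λ s → f (d-1 ∷ s)) ss + (count (λ s → f (d0 ∷ s)) ss + count (λ s → f (d1 ∷ s)) ss)
  go []       = refl
  go (s ∷ ss) rewrite go ss = shuffle
    (if f (d-1 ∷ s) then 1 else 0) (if f (d0 ∷ s) then 1 else 0) (if f (d1 ∷ s) then 1 else 0)
    (count (λ s → f (d-1 ∷ s)) ss) (count (λ s → f (d0 ∷ s)) ss) (count (λ s → f (d1 ∷ s)) ss)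
    where
    shuffle : ∀ a b c x y z → a + (b + (c + (x + (y + z)))) ≡ (a + x) + ((b + y) + (c + z))
    shuffle = solve-∀

reducedNAF : List Digit → Bool
reducedNAF s = nonAdjacent s ∧ leadingNonzero s

reducedNAF-d0 : ∀ s → reducedNAF (d0 ∷ s) ≡ reducedNAF s
reducedNAF-d0 []      = refl
reducedNAF-d0 (_ ∷ _) = refl

reducedNAF-d-1 : ∀ s → reducedNAF (d-1 ∷ s) ≡ reducedNAF (d1 ∷ s)
reducedNAF-d-1 []      = refl
reducedNAF-d-1 (_ ∷ _) = refl

nafCount nafCount₁ : ℕ → ℕ
nafCount  m = count reducedNAF (strings m)
nafCount₁ m = count (λ s → reducedNAF (d1 ∷ s)) (strings m)

nafCount-suc : ∀ m → nafCount (suc m) ≡ nafCount₁ m + (nafCount m + nafCount₁ m)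
nafCount-suc m = trans (count-strings-suc reducedNAF m)
  (cong₂ _+_ (count-cong reducedNAF-d-1 (strings m))
             (cong (_+ nafCount₁ m) (count-cong reducedNAF-d0 (strings m))))

nafCount₁-suc : ∀ m → nafCount₁ (suc m) ≡ nafCount m
nafCount₁-suc m = begin
  nafCount₁ (suc m)                                      ≡⟨ count-strings-suc (λ s → reducedNAF (d1 ∷ s)) m ⟩
  count (λ _ → false) ss + (count (λ s → reducedNAF (d0 ∷ s)) ss + count (λ _ → false) ss)
    ≡⟨ cong₂ _+_ (count-false ss) (cong₂ _+_ (count-cong reducedNAF-d0 ss) (count-false ss)) ⟩
  nafCount m + 0                                         ≡⟨ ℕ.+-identityʳ (nafCount m) ⟩
  nafCount m                                             ∎
  where
  open ≡-Reasoning
  ss = strings m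

nafCount+nafCount₁ : ∀ m → nafCount m + nafCount₁ m ≡ 2 ^ m
nafCount+nafCount₁ zero    = refl
nafCount+nafCount₁ (suc m) = begin
  nafCount (suc m) + nafCount₁ (suc m)   ≡⟨ cong₂ _+_ (nafCount-suc m) (nafCount₁-suc m) ⟩
  R + (N + R) + N                        ≡⟨ double-sum N R ⟩
  2 * (N + R)                            ≡⟨ cong (2 *_) (nafCount+nafCount₁ m) ⟩
  2 ^ suc m                              ∎
  where
  open ≡-Reasoning
  N = nafCount m
  R = nafCount₁ m
  double-sum : ∀ n r → r + (n + r) + n ≡ 2 * (n + r)
  double-sum = solve-∀

nafCount-suc-suc : ∀ m → nafCount (suc (suc m)) ≡ nafCount m + 2 ^ suc m
nafCount-suc-suc m = trans (nafCount-suc (suc m))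
  (cong₂ _+_ (nafCount₁-suc m) (nafCount+nafCount₁ (suc m)))

cardI≤nafCount : ∀ m → cardI m ≤ nafCount m
cardI≤nafCount m = begin
  cardI m                      ≡⟨ length-filter≡count positiveReducedNAF (strings m) ⟩
  count positiveReducedNAF (strings m) ≤⟨ count-mono reduced (strings m) ⟩
  nafCount m                   ∎
  where
  open ℕ.≤-Reasoning
  positiveReducedNAF : List Digit → Bool
  positiveReducedNAF s = nonAdjacent s ∧ leadingNonzero s ∧ isPositive (value s)
  reduced : ∀ s → positiveReducedNAF s ≡ true → reducedNAF s ≡ true
  reduced s h with nonAdjacent s | leadingNonzero s
  ... | true | true = refl


2^suc<3*a : ∀ m → 2 ^ suc m < 3 * a (suc m)
2^suc<3*a zero          = s≤s (s≤s (s≤s z≤n))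
2^suc<3*a (suc zero)    = s≤s (s≤s (s≤s (s≤s (s≤s z≤n))))
2^suc<3*a (suc (suc m)) = begin-strict
  2 ^ suc (suc (suc m)) ≡⟨ four-times (2 ^ suc m) ⟩
  3 * X + X             <⟨ ℕ.+-monoʳ-< (3 * X) (2^suc<3*a m) ⟩
  3 * X + 3 * A         ≡⟨ ℕ.*-distribˡ-+ 3 X A ⟨
  3 * (X + A)           ∎
  where
  open ℕ.≤-Reasoning
  X = 2 ^ suc m
  A = a (suc m)
  four-times : ∀ x → 2 * (2 * x) ≡ 3 * x + x
  four-times = solve-∀

2^∸≤double : ∀ m {n} → a (suc m) ≤ n → 2 ^ suc m ∸ n ≤ double n
2^∸≤double m {n} a≤n = ℕ.m≤n+o⇒m∸n≤o (2 ^ suc m) n (begin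
  2 ^ suc m      ≤⟨ ℕ.<⇒≤ (2^suc<3*a m) ⟩
  3 * a (suc m)  ≤⟨ ℕ.*-monoʳ-≤ 3 a≤n ⟩
  3 * n          ≡⟨ cong (λ k → n + k) (double≡2* n) ⟨
  n + double n   ∎)
  where open ℕ.≤-Reasoning

a≤1+nafCount : ∀ m → a (suc m) ≤ suc (nafCount m)
a≤1+nafCount zero          = s≤s z≤n
a≤1+nafCount (suc zero)    = s≤s (s≤s z≤n)
a≤1+nafCount (suc (suc m)) = begin
  2 ^ suc m + a (suc m)          ≤⟨ ℕ.+-monoʳ-≤ (2 ^ suc m) (a≤1+nafCount m) ⟩
  2 ^ suc m + suc (nafCount m)   ≡⟨ ℕ.+-suc (2 ^ suc m) (nafCount m) ⟩
  suc (2 ^ suc m + nafCount m)   ≡⟨ cong suc (ℕ.+-comm (2 ^ suc m) (nafCount m)) ⟩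
  suc (nafCount m + 2 ^ suc m)   ≡⟨ cong suc (nafCount-suc-suc m) ⟨
  suc (nafCount (suc (suc m)))   ∎
  where open ℕ.≤-Reasoning

a+v≤2^ : ∀ m {v} → v < cardI (suc m) → a (suc m) + v ≤ 2 ^ suc m
a+v≤2^ m {v} v<|I| = ℕ.≤-pred (begin-strict
  a (suc m) + v                           <⟨ ℕ.+-monoʳ-< (a (suc m)) v<|I| ⟩
  a (suc m) + cardI (suc m)               ≤⟨ ℕ.+-mono-≤ (a≤1+nafCount m) (cardI≤nafCount (suc m)) ⟩
  suc (nafCount m + nafCount (suc m))     ≡⟨ cong suc (ℕ.+-comm (nafCount m) _) ⟩
  suc (nafCount (suc m) + nafCount m)     ≡⟨ cong (λ k → suc (nafCount (suc m) + k)) (nafCount₁-suc m) ⟨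
  suc (nafCount (suc m) + nafCount₁ (suc m)) ≡⟨ cong suc (nafCount+nafCount₁ (suc m)) ⟩
  suc (2 ^ suc m)                         ∎)
  where open ℕ.≤-Reasoning

mainTheorem10 : (k v : ℕ) → 3 ≤ k → v < cardI (k ∸ 2) →
    (deg (B (a k + v)) ≡ map suc (deg (B (a (k ∸ 2) + v))))
      × (lc (B (a k + v)) ≡ lc (B (a (k ∸ 2) + v)))
mainTheorem10 k@(suc (suc (suc m))) v _ v<|I| = deg-lc-lead-shift (B n) (B (a k + v)) (begin
  lead (B (2 ^ M + a M + v))      ≡⟨ cong (λ i → lead (B i)) (ℕ.+-assoc (2 ^ M) (a M) v) ⟩
  lead (B (2 ^ M + n))            ≡⟨ lead-cong (B-2^m+n M n+j≡2^M) ⟩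
  lead (tMul (B n) ⊕ B j)         ≡⟨ lead-tMul-⊕ (B n) (B j) (degree-B-dominates M n+j≡2^M j≤2n) ⟩
  map (map₁ suc) (lead (B n))     ∎)
  where
  open ≡-Reasoning
  M = suc m
  n = a M + v
  j = 2 ^ M ∸ n
  n+j≡2^M : n + j ≡ 2 ^ M
  n+j≡2^M = ℕ.m+[n∸m]≡n (a+v≤2^ m v<|I|)
  j≤2n : j ≤ double n
  j≤2n = 2^∸≤double m (ℕ.m≤m+n (a M) v)
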